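{- Let $\mathcal{A}=(Q,E,s,F)$ be an NFA and let $R$ be a co-lexicographically monotonic relation on $\mathcal{A}$. Then for every $\alpha\in Pref(\mathcal{L}(\mathcal{A}))$ the set $I_\alpha$ is $R$-convex.
   Context: $\Sigma$ is a finite alphabet with a fixed total order $\preceq$, extended co-lexicographically to $\Sigma^*$ ($\alpha\preceq\beta$ iff reverse of $\alpha$ is lexicographically $\le$ reverse of $\beta$; $\prec$ strict). An NFA is $\mathcal{A}=(Q,E,s,F)$ with finite $Q$, $E\subseteq Q\times Q\times\Sigma$; every state is reachable from $s$ and can reach a final state. $I_u$ is the set of strings readable from $s$ to $u$; $I_\alpha$ the set of states $u$ with $\alpha\in I_u$; $Pref(\mathcal{L}(\mathcal{A}))$ the prefixes of accepted strings. On $\{I_u:u\in Q\}$, $\preceq$ is the reflexive relation with, for $I_u\neq I_v$: $I_u\prec I_v$ iff for all $\alpha\in I_u,\beta\in I_v$ with $\{\alpha,\beta\}\not\subseteq I_u\cap I_v$, $\alpha\prec\beta$. A reflexive relation $R$ on $Q$ is co-lexicographically monotonic if $(u,v)\in R$ implies $I_u\preceq I_v$. $U\subseteq Q$ is $R$-convex if $u,z\in U$, $(u,v)\in R$, $(v,z)\in R$ imply $v\in U$. -}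

module Defs where

open import Data.Nat using (ℕ)
open import Data.Fin using (Fin)
import Data.Fin as F
open import Data.Bool using (Bool; true)
open import Data.List using (List; []; _∷_; _++_; reverse)
open import Data.List.Relation.Binary.Lex.Strict using (Lex-<)
open import Data.Product using (Σ; ∃; _×_)
open import Relation.Binary.PropositionalEquality using (_≡_)
open import Relation.Nullary using (¬_)

-- Alphabet: Fin σ, totally ordered by the natural order on Fin
-- (every finite totally ordered alphabet is isomorphic to such a one).

_≺ᶜ_ : ∀ {σ} → List (Fin σ) → List (Fin σ) → Set
α ≺ᶜ β = Lex-< _≡_ F._<_ (reverse α) (reverse β)

-- Transition relation of an NFA with state set Fin n over alphabet Fin σ:
-- E u v a ≡ true  means  (u , v , a) ∈ E.
Edges : ℕ → ℕ → Set
Edges n σ = Fin n → Fin n → Fin σ → Bool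

data Path {n σ : ℕ} (E : Edges n σ) : Fin n → List (Fin σ) → Fin n → Set where
  nil  : ∀ {u} → Path E u [] u
  step : ∀ {u w v a α} → E u w a ≡ true → Path E w α v → Path E u (a ∷ α) v

record NFA (n σ : ℕ) : Set where
  field
    E     : Edges n σ
    s     : Fin n
    Final : Fin n → Bool
    reachable   : ∀ u → ∃ λ (α : List (Fin σ)) → Path E s α u
    coreachable : ∀ u → ∃ λ (α : List (Fin σ)) → ∃ λ f → Final f ≡ true × Path E u α f

module _ {n σ : ℕ} (A : NFA n σ) where
  open NFA A

  _∈I_ : List (Fin σ) → Fin n → Set
  α ∈I u = Path E s α u

  Iα : List (Fin σ) → Fin n → Set
  Iα α u = α ∈I u

  Pref : List (Fin σ) → Set
  Pref α = ∃ λ (β : List (Fin σ)) → ∃ λ f → Final f ≡ true × Path E s (α ++ β) f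

  SameI : Fin n → Fin n → Set
  SameI u v = ∀ α → (α ∈I u → α ∈I v) × (α ∈I v → α ∈I u)

  -- I_u ≺ I_v (only meaningful when I_u ≠ I_v)
  StrictI : Fin n → Fin n → Set
  StrictI u v = ∀ α β → α ∈I u → β ∈I v →
                ¬ ((α ∈I u × α ∈I v) × (β ∈I u × β ∈I v)) → α ≺ᶜ β

  data _⪯I_ (u v : Fin n) : Set where
    same : SameI u v → u ⪯I v
    less : ¬ SameI u v → StrictI u v → u ⪯I v

  Reflexive : (Fin n → Fin n → Set) → Set
  Reflexive R = ∀ u → R u u

  CoLexMonotonic : (Fin n → Fin n → Set) → Set
  CoLexMonotonic R = Reflexive R × (∀ u v → R u v → u ⪯I v)

Convex : ∀ {n} → (Fin n → Fin n → Set) → (Fin n → Set) → Set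
Convex {n} R U = ∀ (u v z : Fin n) → U u → U z → R u v → R v z → U v

{-# OPTIONS --safe #-}
module Submission where

open import Defs
open import Data.Nat using (ℕ)
open import Data.Fin using (Fin)
import Data.Fin.Properties as Fin
open import Data.List using (List; []; _∷_)
open import Data.List.Relation.Binary.Lex.Strict using (<-asymmetric)
open import Data.Bool using (true)
import Data.Bool.Properties as Bool
open import Data.Product using (_,_; proj₁; proj₂)
open import Data.Empty using (⊥-elim)
open import Relation.Binary.PropositionalEquality using (refl; sym)
open import Relation.Nullary using (¬_; Dec; yes; no)
open import Relation.Nullary.Decidable using (_×-dec_)

-- If α ∉ I_v, a string β ∈ I_v would satisfy α ≺ β (from I_u ⪯ I_v) and
-- β ≺ α (from I_v ⪯ I_z); as co-lex order is asymmetric, such β cannot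
-- exist, yet every state is reachable. Deciding α ∈ I_v (paths in a finite
-- automaton are decidable) turns this contradiction into a proof of α ∈ I_v.

path? : ∀ {n σ} (E : Edges n σ) u (α : List (Fin σ)) v → Dec (Path E u α v)
path? E u [] v with u Fin.≟ v
... | yes refl = yes nil
... | no u≢v   = no λ { nil → u≢v refl }
path? E u (a ∷ α) v
  with Fin.any? (λ w → (E u w a Bool.≟ true) ×-dec path? E w α v)
... | yes (w , e , p) = yes (step e p)
... | no ¬step        = no λ { (step e p) → ¬step (_ , e , p) }

≺ᶜ-asym : ∀ {σ} (α β : List (Fin σ)) → α ≺ᶜ β → ¬ β ≺ᶜ α
≺ᶜ-asym _ _ = <-asymmetric sym Fin.<-resp₂-≡ Fin.<-asym

module _ {n σ : ℕ} (A : NFA n σ) where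
  ⪯I-below-missing : ∀ {u v α β} → _⪯I_ A u v →
    _∈I_ A α u → ¬ _∈I_ A α v → _∈I_ A β v → α ≺ᶜ β
  ⪯I-below-missing (same u≡v)  αu α∉v βv = ⊥-elim (α∉v (proj₁ (u≡v _) αu))
  ⪯I-below-missing (less _ u≺v) αu α∉v βv =
    u≺v _ _ αu βv λ ((_ , αv) , _) → α∉v αv

  ⪯I-above-missing : ∀ {v z α β} → _⪯I_ A v z →
    _∈I_ A α z → ¬ _∈I_ A α v → _∈I_ A β v → β ≺ᶜ α
  ⪯I-above-missing (same v≡z)  αz α∉v βv = ⊥-elim (α∉v (proj₂ (v≡z _) αz))
  ⪯I-above-missing (less _ v≺z) αz α∉v βv =
    v≺z _ _ βv αz λ (_ , (αv , _)) → α∉v αv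

lemma18 : ∀ {n σ : ℕ} (A : NFA n σ) (R : Fin n → Fin n → Set) →
    CoLexMonotonic A R →
    ∀ (α : List (Fin σ)) → Pref A α → Convex R (Iα A α)
lemma18 A R (_ , monotonic) α _ u v z αu αz uRv vRz
  with path? (NFA.E A) (NFA.s A) α v
... | yes αv  = αv
... | no α∉v  = ⊥-elim (≺ᶜ-asym α β α≺β β≺α)
  where
  β : List _
  β = proj₁ (NFA.reachable A v)
  βv : _∈I_ A β v
  βv = proj₂ (NFA.reachable A v)
  α≺β : α ≺ᶜ β
  α≺β = ⪯I-below-missing A (monotonic u v uRv) αu α∉v βv
  β≺α : β ≺ᶜ α
  β≺α = ⪯I-above-missing A (monotonic v z vRz) αz α∉v βv
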